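{- Let $G$ be a connected planar graph. Every minimal $2$-contraction of $G$ either contains a non-damaged vertex of degree at most $4$ or is $3$-connected.
   Context: Graphs are finite, simple, undirected. A graph $H$ on at least $3$ vertices is a $2$-contraction of $G$ if there is an edge $u_1u_2\in E(H)$ such that $H\setminus u_1u_2$ is a subgraph of $G$, every vertex $v\notin\{u_1,u_2\}$ of $H$ satisfies $d_H(v)=d_G(v)$, and $G$ contains a $(u_1,u_2)$-path all of whose internal vertices lie in $V(G)\setminus V(H)$. The vertices $u_1,u_2$ are the damaged vertices (the 2-contraction is considered together with this choice). A $2$-contraction $H'$ of $G$ is smaller than a $2$-contraction $H$ with damaged vertices $\{u_1,u_2\}$ if $V(H')\subsetneq V(H)$ and each of $u_1,u_2$ either is not in $V(H')$ or is a damaged vertex of $H'$. A $2$-contraction $H$ is minimal if $G$ admits no $2$-contraction smaller than $H$. -}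

module Defs where

open import Data.Nat using (ℕ; zero; suc; _≤_)
open import Data.Fin using (Fin; _<_)
open import Data.Bool using (Bool; true; false; if_then_else_)
open import Data.List using (List; []; _∷_; _++_; map; length; allFin)
open import Data.Nat.ListAction using (sum)
open import Data.List.Membership.Propositional using (_∈_; _∉_)
open import Data.List.Relation.Unary.All using (All)
open import Data.List.Relation.Unary.Unique.Propositional using (Unique)
open import Data.Product using (Σ; ∃; ∃-syntax; _×_; _,_)
open import Data.Sum using (_⊎_)
open import Data.Unit using (⊤)
open import Data.Empty using (⊥)
open import Relation.Nullary using (¬_)
open import Relation.Binary.PropositionalEquality using (_≡_; _≢_)
open import Data.Rational using (ℚ; 0ℚ; 1ℚ) renaming (_+_ to _+ℚ_; _*_ to _*ℚ_; _-_ to _-ℚ_; _≤_ to _≤ℚ_)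

record Graph (n : ℕ) : Set where
  field
    adj    : Fin n → Fin n → Bool
    sym    : ∀ u v → adj u v ≡ adj v u
    irrefl : ∀ u → adj u u ≡ false

count : ∀ {n} → (Fin n → Bool) → ℕ
count {n} p = sum (map (λ v → if p v then 1 else 0) (allFin n))

deg : ∀ {n} → (Fin n → Fin n → Bool) → Fin n → ℕ
deg A u = count (A u)

IsWalk : ∀ {n} → (Fin n → Fin n → Bool) → List (Fin n) → Set
IsWalk A []            = ⊤
IsWalk A (x ∷ [])      = ⊤
IsWalk A (x ∷ y ∷ vs)  = (A x y ≡ true) × IsWalk A (y ∷ vs)

Connected : ∀ {n} → Graph n → Set
Connected {n} G = ∀ (x y : Fin n) →
  x ≡ y ⊎ ∃[ ws ] IsWalk (Graph.adj G) (x ∷ ws ++ y ∷ [])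

-- Planarity: a drawing in the plane with vertices as distinct points and
-- edges as polygonal curves (rational coordinates), such that the curve of an
-- edge passes through no other vertex and curves of distinct edges meet only
-- in common end vertices.

Point : Set
Point = ℚ × ℚ

OnSeg : Point → Point → Point → Set
OnSeg (x₁ , x₂) (p₁ , p₂) (q₁ , q₂) =
  ∃[ t ] (0ℚ ≤ℚ t) × (t ≤ℚ 1ℚ)
       × (x₁ ≡ p₁ +ℚ t *ℚ (q₁ -ℚ p₁)) × (x₂ ≡ p₂ +ℚ t *ℚ (q₂ -ℚ p₂))

OnPoly : Point → List Point → Set
OnPoly x []           = ⊥
OnPoly x (p ∷ [])     = x ≡ p
OnPoly x (p ∷ q ∷ ps) = OnSeg x p q ⊎ OnPoly x (q ∷ ps)

record PlaneDrawing {n : ℕ} (G : Graph n) : Set where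
  open Graph G
  field
    pos    : Fin n → Point
    mid    : Fin n → Fin n → List Point   -- bends of the curve of edge uv (u < v)
  curve : Fin n → Fin n → List Point
  curve u v = pos u ∷ mid u v ++ pos v ∷ []
  field
    pos-inj : ∀ u v → pos u ≡ pos v → u ≡ v
    avoid   : ∀ u v w → u < v → adj u v ≡ true → w ≢ u → w ≢ v →
              ¬ OnPoly (pos w) (curve u v)
    disjoint : ∀ u v u' v' → u < v → adj u v ≡ true → u' < v' → adj u' v' ≡ true →
               ¬ (u ≡ u' × v ≡ v') →
               ∀ x → OnPoly x (curve u v) → OnPoly x (curve u' v') →
               ∃[ w ] (w ≡ u ⊎ w ≡ v) × (w ≡ u' ⊎ w ≡ v') × (x ≡ pos w)

Planar : ∀ {n} → Graph n → Set
Planar G = PlaneDrawing G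

-- 2-contractions. H has vertex set {v | inV v ≡ true} ⊆ V(G), edge relation
-- hadj, and damaged vertices u₁ u₂.

record TwoContraction {n : ℕ} (G : Graph n) : Set where
  open Graph G
  field
    inV    : Fin n → Bool
    hadj   : Fin n → Fin n → Bool
    hsym   : ∀ u v → hadj u v ≡ hadj v u
    hirr   : ∀ u → hadj u u ≡ false
    hdom   : ∀ u v → hadj u v ≡ true → inV u ≡ true
    size≥3 : 3 ≤ count inV
    u₁ u₂  : Fin n
    u₁∈    : inV u₁ ≡ true
    u₂∈    : inV u₂ ≡ true
    u₁≢u₂  : u₁ ≢ u₂
    edge   : hadj u₁ u₂ ≡ true
    sub    : ∀ x y → hadj x y ≡ true →
             ¬ ((x ≡ u₁ × y ≡ u₂) ⊎ (x ≡ u₂ × y ≡ u₁)) → adj x y ≡ true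
    degEq  : ∀ v → inV v ≡ true → v ≢ u₁ → v ≢ u₂ → deg hadj v ≡ deg adj v
    path   : ∃[ ws ] IsWalk adj (u₁ ∷ ws ++ u₂ ∷ [])
                   × Unique (u₁ ∷ ws ++ u₂ ∷ [])
                   × All (λ w → inV w ≡ false) ws

module _ {n : ℕ} {G : Graph n} where
  open TwoContraction

  Smaller : TwoContraction G → TwoContraction G → Set
  Smaller H' H =
      (∀ v → inV H' v ≡ true → inV H v ≡ true)
    × (∃[ v ] inV H v ≡ true × inV H' v ≡ false)
    × Ok (u₁ H) × Ok (u₂ H)
    where
      Ok : Fin n → Set
      Ok u = inV H' u ≡ false ⊎ (u ≡ u₁ H' ⊎ u ≡ u₂ H')

  Minimal : TwoContraction G → Set
  Minimal H = ∀ (H' : TwoContraction G) → ¬ Smaller H' H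

  ThreeConnected : TwoContraction G → Set
  ThreeConnected H =
      (4 ≤ count (inV H))
    × (∀ (X : List (Fin n)) → length X ≤ 2 →
       ∀ x y → inV H x ≡ true → inV H y ≡ true → x ∉ X → y ∉ X →
       x ≡ y ⊎ ∃[ ws ] IsWalk (hadj H) (x ∷ ws ++ y ∷ []) × All (_∉ X) ws)

  HasLowNonDamaged : TwoContraction G → Set
  HasLowNonDamaged H =
    ∃[ v ] inV H v ≡ true × v ≢ u₁ H × v ≢ u₂ H × deg (hadj H) v ≤ 4

{-# OPTIONS --safe #-}
module Submission where

-- It suffices that every undamaged vertex of H has degree at least 3, which also gives H at
-- least four vertices. If a set A of at most two vertices separates H then, as the damaged
-- vertices are adjacent, some side S of the separation contains neither of them, so the
-- vertices of S have the same degree in H as in G. The subgraph of H on S ∪ A plus an edge ab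
-- with A ⊆ {a, b} is then a 2-contraction smaller than H, provided G has an a–b path avoiding
-- S ∪ A. If b ∈ S, the edge ab of H has an undamaged end, so it is such a path. Otherwise
-- A = {a, b}, and if G has no such path, the vertices of H that G reaches from a outside S ∪ A
-- form a side separated by a alone, or, if there are none, S ∪ {a} is a side separated by b
-- alone; both cases were already excluded.

open import Defs
open import Function using (_∘_)
open import Data.Nat using (ℕ; zero; suc; _+_; _≤_; _<_; z≤n; s≤s; _≤?_)
open import Data.Nat.Properties
  using (≤-refl; ≤-trans; ≤-reflexive; +-mono-≤; +-suc; +-identityʳ; m≤n+m; ≤-pred; ≰⇒>;
         <-irrefl; <-≤-trans; ≤-<-trans)
open import Data.Fin using (Fin; zero; suc)
open import Data.Fin.Properties using (_≟_; any?)
open import Data.Bool using (Bool; true; false; _∧_; _∨_; not; if_then_else_)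
open import Data.Bool.Properties using (not-¬; ¬-not; ∧-conicalˡ; ∧-conicalʳ) renaming (_≟_ to _≟ᵇ_)
open import Data.List using (List; []; _∷_; _++_; allFin; length)
open import Data.List.Properties using (map-tabulate; map-cong)
open import Data.Nat.ListAction using (sum)
open import Data.List.Membership.Propositional using (_∈_; _∉_)
open import Data.List.Relation.Unary.Any using (here; there)
open import Data.List.Relation.Unary.All as All using (All; []; _∷_)
open import Data.List.Relation.Unary.All.Properties using (++⁺)
open import Data.List.Relation.Unary.AllPairs using ([]; _∷_)
open import Data.List.Relation.Unary.Unique.Propositional using (Unique)
import Data.List.Relation.Unary.Unique.Propositional.Properties as Unique
import Data.List.Membership.DecPropositional as DecMembership
open import Data.Product using (∃; ∃₂; _×_; _,_; proj₁; proj₂)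
open import Data.Sum using (_⊎_; inj₁; inj₂; [_,_]; fromInj₁)
open import Data.Unit using (tt)
open import Data.Empty using (⊥; ⊥-elim)
open import Relation.Nullary using (¬_; Dec; yes; no; does; ¬?; _×-dec_; _⊎-dec_)
open import Relation.Unary using (Decidable)
open import Relation.Nullary.Decidable using (dec-true; dec-false; toSum; decidable-stable)
open import Relation.Binary.PropositionalEquality using (_≡_; _≢_; refl; sym; trans; cong)

bool-ext : {b c : Bool} → (b ≡ true → c ≡ true) → (c ≡ true → b ≡ true) → b ≡ c
bool-ext {false} {false} _   _   = refl
bool-ext {false} {true}  _   c⇒b = c⇒b refl
bool-ext {true}  {false} b⇒c _   = sym (b⇒c refl)
bool-ext {true}  {true}  _   _   = refl

from-does : {A : Set} (a? : Dec A) → does a? ≡ true → A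
from-does (yes a) _ = a
from-does (no _) ()

indicator : Bool → ℕ
indicator b = if b then 1 else 0

indicator≤1 : ∀ b → indicator b ≤ 1
indicator≤1 false = z≤n
indicator≤1 true  = ≤-refl

indicator-mono : {b c : Bool} → (b ≡ true → c ≡ true) → indicator b ≤ indicator c
indicator-mono {false} _   = z≤n
indicator-mono {true}  b⇒c rewrite b⇒c refl = ≤-refl

infix 4 _⊆_
_⊆_ : ∀ {n} → (Fin n → Bool) → (Fin n → Bool) → Set
p ⊆ q = ∀ v → p v ≡ true → q v ≡ true

count-cong : ∀ {n} {p q : Fin n → Bool} → (∀ v → p v ≡ q v) → count p ≡ count q
count-cong {n} p≗q = cong sum (map-cong (cong indicator ∘ p≗q) (allFin n))

count-suc : ∀ {n} (p : Fin (suc n) → Bool) → count p ≡ indicator (p zero) + count (p ∘ suc)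
count-suc p = cong (λ xs → indicator (p zero) + sum xs)
  (trans (map-tabulate suc (indicator ∘ p)) (sym (map-tabulate (λ v → v) (indicator ∘ p ∘ suc))))

count≤size : ∀ {n} (p : Fin n → Bool) → count p ≤ n
count≤size {zero}  p = z≤n
count≤size {suc n} p rewrite count-suc p = +-mono-≤ (indicator≤1 (p zero)) (count≤size (p ∘ suc))

count-mono : ∀ {n} {p q : Fin n → Bool} → p ⊆ q → count p ≤ count q
count-mono {zero}          _   = z≤n
count-mono {suc n} {p} {q} p⊆q rewrite count-suc p | count-suc q =
  +-mono-≤ (indicator-mono (p⊆q zero)) (count-mono (p⊆q ∘ suc))

count-mono-< : ∀ {n} {p q : Fin n → Bool} → p ⊆ q →
               ∀ a → q a ≡ true → p a ≡ false → count p < count q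
count-mono-< {suc n} {p} {q} p⊆q zero qa pa rewrite count-suc p | count-suc q | qa | pa =
  s≤s (count-mono (p⊆q ∘ suc))
count-mono-< {suc n} {p} {q} p⊆q (suc a) qa pa rewrite count-suc p | count-suc q =
  ≤-trans (≤-reflexive (sym (+-suc (indicator (p zero)) _)))
          (+-mono-≤ (indicator-mono (p⊆q zero)) (count-mono-< (p⊆q ∘ suc) a qa pa))

count-nonempty : ∀ {n} (p : Fin n → Bool) → 0 < count p → ∃ λ v → p v ≡ true
count-nonempty {suc n} p pos rewrite count-suc p with p zero in p0
... | true  = zero , p0
... | false with count-nonempty (p ∘ suc) pos
...   | v , pv = suc v , pv

count-remove : ∀ {n} (p : Fin n → Bool) (a : Fin n) →
               count p ≤ suc (count (λ v → not (does (v ≟ a)) ∧ p v))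
count-remove {suc n} p zero rewrite count-suc p | count-suc (λ v → not (does (v ≟ zero)) ∧ p v) =
  +-mono-≤ (indicator≤1 (p zero)) ≤-refl
count-remove {suc n} p (suc a)
  rewrite count-suc p | count-suc (λ v → not (does (v ≟ suc a)) ∧ p v) =
  ≤-trans (+-mono-≤ (≤-refl {indicator (p zero)}) (count-remove (p ∘ suc) a))
          (≤-reflexive (+-suc (indicator (p zero)) _))

unique-snoc : ∀ {A : Set} {xs : List A} {z} → Unique xs → z ∉ xs → Unique (xs ++ z ∷ [])
unique-snoc u z∉xs = Unique.++⁺ u ([] ∷ []) λ { (z∈xs , here refl) → z∉xs z∈xs }

module _ {n : ℕ} (E : Fin n → Fin n → Bool) where

  walk-snoc : ∀ x ws y {z} → IsWalk E (x ∷ ws ++ y ∷ []) → E y z ≡ true →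
              IsWalk E (x ∷ (ws ++ y ∷ []) ++ z ∷ [])
  walk-snoc x []       y (xy , _) yz = xy , yz , tt
  walk-snoc x (w ∷ ws) y (xw , w⋯y) yz = xw , walk-snoc w ws y w⋯y yz

  record Path (P : Fin n → Set) (x y : Fin n) : Set where
    field
      interior   : List (Fin n)
      walk       : IsWalk E (x ∷ interior ++ y ∷ [])
      unique     : Unique (x ∷ interior ++ y ∷ [])
      interior-P : All P interior

  module _ {P : Fin n → Set} where

    edge-path : ∀ {x y} → x ≢ y → E x y ≡ true → Path P x y
    edge-path x≢y xy = record
      { interior = [] ; walk = xy , tt ; unique = (x≢y ∷ []) ∷ [] ∷ [] ; interior-P = [] }

    path-snoc : ∀ {x y z} (p : Path P x y) → P y → E y z ≡ true →
                z ∉ x ∷ Path.interior p ++ y ∷ [] → Path P x z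
    path-snoc {x} {y} p Py yz fresh = record
      { interior   = interior ++ y ∷ []
      ; walk       = walk-snoc x interior y walk yz
      ; unique     = unique-snoc unique fresh
      ; interior-P = ++⁺ interior-P (Py ∷ []) }
      where open Path p

  path-map : ∀ {P Q : Fin n → Set} {x y} → (∀ {v} → P v → Q v) → Path P x y → Path Q x y
  path-map P⇒Q p = record { Path p ; interior-P = All.map P⇒Q (Path.interior-P p) }

module Reachability {n : ℕ} (E : Fin n → Fin n → Bool) {P : Fin n → Set} (P? : Decidable P)
                    (s : Fin n) where

  Closed : (Fin n → Bool) → Set
  Closed R = ∀ v w → R v ≡ true → E v w ≡ true → P w → R w ≡ true

  record Reachable : Set where
    field
      R        : Fin n → Bool
      R-source : R s ≡ true
      R-sound  : ∀ v → R v ≡ true → v ≡ s ⊎ (P v × Path E P s v)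
      R-closed : Closed R

  private
    -- Keeping the paths inside R lets them be extended by a vertex outside R without repetition.
    Tracked : (Fin n → Bool) → Set
    Tracked R = ∀ v → R v ≡ true → v ≡ s ⊎ (P v × Path E (λ u → P u × R u ≡ true) s v)

    Frontier : (Fin n → Bool) → Fin n → Fin n → Set
    Frontier R v w = R v ≡ true × E v w ≡ true × P w × R w ≡ false

    frontier? : ∀ R → Dec (∃₂ (Frontier R))
    frontier? R = any? λ v → any? λ w →
      R v ≟ᵇ true ×-dec E v w ≟ᵇ true ×-dec P? w ×-dec R w ≟ᵇ false

    saturated : ∀ {R} → ¬ ∃₂ (Frontier R) → Closed R
    saturated none v w Rv vw Pw = ¬-not λ w∉R → none (v , w , Rv , vw , Pw , w∉R)

    insert : Fin n → (Fin n → Bool) → Fin n → Bool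
    insert w R v = does (v ≟ w) ∨ R v

    ⊆-insert : ∀ {R} w → R ⊆ insert w R
    ⊆-insert w v Rv with does (v ≟ w)
    ... | true  = refl
    ... | false = Rv

    insert-self : ∀ {R} w → insert w R w ≡ true
    insert-self w rewrite dec-true (w ≟ w) refl = refl

    grows : ∀ {R v w} → Frontier R v w → count R < count (insert w R)
    grows {R} {w = w} (_ , _ , _ , w∉R) = count-mono-< (⊆-insert {R} w) w (insert-self {R} w) w∉R

    tracked-insert : ∀ {R v w} → R s ≡ true → Tracked R → Frontier R v w → Tracked (insert w R)
    tracked-insert {R} {v} {w} Rs tracked (Rv , vw , Pw , w∉R) u u∈ = by-cases (u ≟ w) u∈
      where
      grow : ∀ {x} → P x × R x ≡ true → P x × insert w R x ≡ true
      grow {x} (Px , Rx) = Px , ⊆-insert {R} w x Rx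
      fresh : ∀ {x} → R x ≡ true → x ≢ w
      fresh Rx refl = not-¬ Rx w∉R
      extend : v ≡ s ⊎ (P v × Path E _ s v) → Path E _ s w
      extend (inj₁ refl)     = edge-path E (fresh Rs) vw
      extend (inj₂ (Pv , p)) = path-snoc E (path-map E grow p) (grow (Pv , Rv)) vw λ w∈ →
        fresh (All.lookup (Rs ∷ ++⁺ (All.map proj₂ (Path.interior-P p)) (Rv ∷ [])) w∈) refl
      by-cases : (u≟w : Dec (u ≡ w)) → does u≟w ∨ R u ≡ true → u ≡ s ⊎ (P u × Path E _ s u)
      by-cases (yes refl) _  = inj₂ (Pw , extend (tracked v Rv))
      by-cases (no _)     Ru = Data.Sum.map₂ (Data.Product.map₂ (path-map E grow)) (tracked u Ru)

    -- Each round adds a vertex, and there are only n of them.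
    saturate : ∀ fuel R → R s ≡ true → Tracked R → n ≤ count R + fuel → Reachable
    saturate fuel R Rs tracked bound with frontier? R
    ... | no none = record
      { R = R ; R-source = Rs ; R-closed = saturated none
      ; R-sound = λ v Rv → Data.Sum.map₂ (Data.Product.map₂ (path-map E proj₁)) (tracked v Rv) }
    ... | yes (v , w , new) with fuel
    ...   | zero = ⊥-elim (<-irrefl refl (<-≤-trans overfull (count≤size (insert w R))))
      where
      overfull : n < count (insert w R)
      overfull = ≤-<-trans (≤-trans bound (≤-reflexive (+-identityʳ (count R)))) (grows new)
    ...   | suc fuel′ =
      saturate fuel′ (insert w R) (⊆-insert {R} w s Rs) (tracked-insert Rs tracked new)
        (≤-trans bound (≤-trans (≤-reflexive (+-suc (count R) fuel′)) (+-mono-≤ (grows new) ≤-refl)))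

  reachable : Reachable
  reachable = saturate n (λ v → does (v ≟ s)) (dec-true (s ≟ s) refl)
                (λ v v≡s → inj₁ (from-does (v ≟ s) v≡s)) (m≤n+m n _)

  module _ {R : Fin n → Bool} (closed : Closed R) where

    last-edge-from : ∀ x ws y → IsWalk E (x ∷ ws ++ y ∷ []) → All P ws →
                     R x ≡ true → ∃ λ r → R r ≡ true × E r y ≡ true
    last-edge-from x []       y (xy , _)    []        Rx = x , Rx , xy
    last-edge-from x (w ∷ ws) y (xw , w⋯y) (Pw ∷ Ps) Rx =
      last-edge-from w ws y w⋯y Ps (closed x w Rx xw Pw)

    first-edge-into : (∀ u v → E u v ≡ E v u) →
                      ∀ x ws y → IsWalk E (x ∷ ws ++ y ∷ []) → All P ws →
                      R y ≡ true → ∃ λ r → R r ≡ true × E r x ≡ true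
    first-edge-into E-sym x []       y (xy , _)    []        Ry = y , Ry , trans (E-sym y x) xy
    first-edge-into E-sym x (w ∷ ws) y (xw , w⋯y) (Pw ∷ Ps) Ry
      with first-edge-into E-sym w ws y w⋯y Ps Ry
    ... | r , Rr , rw = w , closed r w Rr rw Pw , trans (E-sym w x) xw

Link : {A : Set} → A → A → A → A → Set
Link p q x y = (x ≡ p × y ≡ q) ⊎ (x ≡ q × y ≡ p)

module _ {A : Set} {p q x y : A} where

  link-sym : Link p q x y → Link p q y x
  link-sym (inj₁ (x≡p , y≡q)) = inj₂ (y≡q , x≡p)
  link-sym (inj₂ (x≡q , y≡p)) = inj₁ (y≡p , x≡q)

  link-ends : Link p q x y → (x ≡ p ⊎ x ≡ q) × (y ≡ p ⊎ y ≡ q)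
  link-ends (inj₁ (x≡p , y≡q)) = inj₁ x≡p , inj₂ y≡q
  link-ends (inj₂ (x≡q , y≡p)) = inj₂ x≡q , inj₁ y≡p

  link-distinct : p ≢ q → Link p q x y → x ≢ y
  link-distinct p≢q (inj₁ (refl , refl)) = p≢q
  link-distinct p≢q (inj₂ (refl , refl)) = p≢q ∘ sym

  link-transfer : ∀ {a b} → p ≢ q → x ≡ a ⊎ x ≡ b → y ≡ a ⊎ y ≡ b →
                  Link p q x y → Link a b x y
  link-transfer _   (inj₁ x≡a)  (inj₂ y≡b)  _ = inj₁ (x≡a , y≡b)
  link-transfer _   (inj₂ x≡b)  (inj₁ y≡a)  _ = inj₂ (x≡b , y≡a)
  link-transfer p≢q (inj₁ refl) (inj₁ refl) l = ⊥-elim (link-distinct p≢q l refl)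
  link-transfer p≢q (inj₂ refl) (inj₂ refl) l = ⊥-elim (link-distinct p≢q l refl)

link? : ∀ {n} (p q x y : Fin n) → Dec (Link p q x y)
link? p q x y = (x ≟ p ×-dec y ≟ q) ⊎-dec (x ≟ q ×-dec y ≟ p)

Damaged : ∀ {n} {G : Graph n} → TwoContraction G → Fin n → Set
Damaged H v = v ≡ TwoContraction.u₁ H ⊎ v ≡ TwoContraction.u₂ H

module Adjacency {n : ℕ} {G : Graph n} (H : TwoContraction G) where
  open TwoContraction H

  hadj-sym : ∀ {v w} → hadj v w ≡ true → hadj w v ≡ true
  hadj-sym {v} {w} vw = trans (hsym w v) vw

  hdomʳ : ∀ {v w} → hadj v w ≡ true → inV w ≡ true
  hdomʳ {v} {w} vw = hdom w v (hadj-sym vw)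

module Shrinking {n : ℕ} {G : Graph n} (H : TwoContraction G) where
  open Graph G using (adj)
  open TwoContraction H
  open Adjacency H

  record Shrinkable : Set where
    field
      W               : Fin n → Bool
      W⊆V             : W ⊆ inV
      a b             : Fin n
      a≢b             : a ≢ b
      a∈W             : W a ≡ true
      b∈W             : W b ≡ true
      inner-undamaged : ∀ v → W v ≡ true → v ≢ a → v ≢ b → ¬ Damaged H v
      inner-closed    : ∀ v → W v ≡ true → v ≢ a → v ≢ b → ∀ w → hadj v w ≡ true → W w ≡ true
      W≥3             : 3 ≤ count W
      z               : Fin n
      z∈V             : inV z ≡ true
      z∉W             : W z ≡ false
      detour          : Path adj (λ w → W w ≡ false) a b

  module _ (σ : Shrinkable) where
    open Shrinkable σ

    private
      damaged⇒end : ∀ v → W v ≡ true → Damaged H v → v ≡ a ⊎ v ≡ b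
      damaged⇒end v Wv dv with v ≟ a | v ≟ b
      ... | yes v≡a | _       = inj₁ v≡a
      ... | no _    | yes v≡b = inj₂ v≡b
      ... | no v≢a  | no v≢b  = ⊥-elim (inner-undamaged v Wv v≢a v≢b dv)

      Edge′ : Fin n → Fin n → Set
      Edge′ x y = W x ≡ true × W y ≡ true × (hadj x y ≡ true ⊎ Link a b x y)

      edge′? : ∀ x y → Dec (Edge′ x y)
      edge′? x y = W x ≟ᵇ true ×-dec W y ≟ᵇ true ×-dec
                   (hadj x y ≟ᵇ true ⊎-dec link? a b x y)

      edge′-sym : ∀ {x y} → Edge′ x y → Edge′ y x
      edge′-sym {x} {y} (Wx , Wy , e) = Wy , Wx , Data.Sum.map hadj-sym link-sym e

      hadj′ : Fin n → Fin n → Bool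
      hadj′ x y = does (edge′? x y)

      inner-hadj′ : ∀ v → W v ≡ true → v ≢ a → v ≢ b → ∀ w → hadj′ v w ≡ hadj v w
      inner-hadj′ v Wv v≢a v≢b w =
        bool-ext to (λ h → dec-true (edge′? v w) (Wv , inner-closed v Wv v≢a v≢b w h , inj₁ h))
        where
        to : hadj′ v w ≡ true → hadj v w ≡ true
        to e with from-does (edge′? v w) e
        ... | _ , _ , inj₁ h = h
        ... | _ , _ , inj₂ l with proj₁ (link-ends l)
        ...   | inj₁ v≡a = ⊥-elim (v≢a v≡a)
        ...   | inj₂ v≡b = ⊥-elim (v≢b v≡b)

      sub′ : ∀ x y → hadj′ x y ≡ true → ¬ Link a b x y → adj x y ≡ true
      sub′ x y e ¬ab with from-does (edge′? x y) e
      ... | _  , _  , inj₂ ab = ⊥-elim (¬ab ab)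
      ... | Wx , Wy , inj₁ h  = sub x y h λ l →
        ¬ab (link-transfer u₁≢u₂ (damaged⇒end x Wx (proj₁ (link-ends l)))
                                 (damaged⇒end y Wy (proj₂ (link-ends l))) l)

    shrink : TwoContraction G
    shrink = record
      { inV    = W
      ; hadj   = hadj′
      ; hsym   = λ x y → bool-ext (dec-true (edge′? y x) ∘ edge′-sym ∘ from-does (edge′? x y))
                                  (dec-true (edge′? x y) ∘ edge′-sym ∘ from-does (edge′? y x))
      ; hirr   = λ x → dec-false (edge′? x x) λ where
                   (_ , _ , inj₁ h) → not-¬ h (hirr x)
                   (_ , _ , inj₂ l) → link-distinct a≢b l refl
      ; hdom   = λ x y e → proj₁ (from-does (edge′? x y) e)
      ; size≥3 = W≥3
      ; u₁ = a ; u₂ = b ; u₁∈ = a∈W ; u₂∈ = b∈W ; u₁≢u₂ = a≢b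
      ; edge   = dec-true (edge′? a b) (a∈W , b∈W , inj₂ (inj₁ (refl , refl)))
      ; sub    = sub′
      ; degEq  = λ v Wv v≢a v≢b → trans (count-cong (inner-hadj′ v Wv v≢a v≢b))
                   (degEq v (W⊆V v Wv) (inner-undamaged v Wv v≢a v≢b ∘ inj₁)
                                       (inner-undamaged v Wv v≢a v≢b ∘ inj₂))
      ; path   = interior , walk , unique , interior-P }
      where
      open Path detour

    shrink-smaller : Smaller shrink H
    shrink-smaller =
      W⊆V , (z , z∈V , z∉W) , outside-or-end u₁ (inj₁ refl) , outside-or-end u₂ (inj₂ refl)
      where
      outside-or-end : ∀ u → Damaged H u → W u ≡ false ⊎ (u ≡ a ⊎ u ≡ b)
      outside-or-end u du with W u in Wu
      ... | false = inj₁ refl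
      ... | true  = inj₂ (damaged⇒end u Wu du)

module Separations {n : ℕ} {G : Graph n} (H : TwoContraction G) where
  open TwoContraction H
  open Adjacency H
  open DecMembership (_≟_ {n}) using (_∈?_)

  record Separation (A : List (Fin n)) : Set where
    field
      S        : Fin n → Bool
      S⊆V      : S ⊆ inV
      A∉S      : ∀ {x} → x ∈ A → S x ≡ false
      S-closed : ∀ v w → S v ≡ true → hadj v w ≡ true → S w ≡ true ⊎ w ∈ A
      s        : Fin n
      s∈S      : S s ≡ true
      t        : Fin n
      t∈V      : inV t ≡ true
      t∉S      : S t ≡ false
      t∉A      : t ∉ A

    S∪A? : ∀ v → Dec (S v ≡ true ⊎ v ∈ A)
    S∪A? v = S v ≟ᵇ true ⊎-dec v ∈? A

    S∪A : Fin n → Bool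
    S∪A v = does (S∪A? v)

    S⊆S∪A : S ⊆ S∪A
    S⊆S∪A v Sv = dec-true (S∪A? v) (inj₁ Sv)

    A⊆S∪A : ∀ {x} → x ∈ A → S∪A x ≡ true
    A⊆S∪A {x} x∈A = dec-true (S∪A? x) (inj₂ x∈A)

    S∪A⊆V : All (λ x → inV x ≡ true) A → S∪A ⊆ inV
    S∪A⊆V A⊆V v e = [ S⊆V v , All.lookup A⊆V ] (from-does (S∪A? v) e)

    t∉S∪A : S∪A t ≡ false
    t∉S∪A = dec-false (S∪A? t) [ not-¬ t∉S , t∉A ]

  record UndamagedSide (A : List (Fin n)) : Set where
    field
      separation : Separation A
    open Separation separation public
    field
      undamaged  : ∀ v → S v ≡ true → ¬ Damaged H v

  module _ {A : List (Fin n)} (σ : Separation A) where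
    open Separation σ

    private
      Outside : Fin n → Set
      Outside v = inV v ≡ true × S v ≡ false × v ∉ A

      outside? : ∀ v → Dec (Outside v)
      outside? v = inV v ≟ᵇ true ×-dec S v ≟ᵇ false ×-dec ¬? (v ∈? A)

      outside-closed : ∀ v w → does (outside? v) ≡ true → hadj v w ≡ true →
                       does (outside? w) ≡ true ⊎ w ∈ A
      outside-closed v w e vw with from-does (outside? v) e
      ... | _ , v∉S , v∉A = Data.Sum.map₁ inside (Data.Sum.swap (toSum (w ∈? A)))
        where
        w∉S : S w ≢ true
        w∉S Sw = [ not-¬ v∉S , v∉A ] (S-closed w v Sw (hadj-sym vw))
        inside : w ∉ A → does (outside? w) ≡ true
        inside w∉A = dec-true (outside? w) (hdomʳ vw , ¬-not w∉S , w∉A)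

    complement : Separation A
    complement = record
      { S        = λ v → does (outside? v)
      ; S⊆V      = λ v e → proj₁ (from-does (outside? v) e)
      ; A∉S      = λ {x} x∈A → dec-false (outside? x) λ (_ , _ , x∉A) → x∉A x∈A
      ; S-closed = outside-closed
      ; s        = t
      ; s∈S      = dec-true (outside? t) (t∈V , t∉S , t∉A)
      ; t        = s
      ; t∈V      = S⊆V s s∈S
      ; t∉S      = dec-false (outside? s) λ (_ , s∉S , _) → not-¬ s∈S s∉S
      ; t∉A      = λ s∈A → not-¬ s∈S (A∉S s∈A) }

    complement-undamaged : (∀ {u} → Damaged H u → S u ≡ true ⊎ u ∈ A) → UndamagedSide A
    complement-undamaged damaged⊆S∪A = record
      { separation = complement
      ; undamaged  = λ v e dv → case-outside (from-does (outside? v) e) (damaged⊆S∪A dv) }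
      where
      case-outside : ∀ {v} → Outside v → ¬ (S v ≡ true ⊎ v ∈ A)
      case-outside (_ , Sv , _)   (inj₁ Sv′) = not-¬ Sv′ Sv
      case-outside (_ , _ , v∉A) (inj₂ v∈A) = v∉A v∈A

  -- As u₁u₂ is an edge, a side containing a damaged vertex contains both up to A, and then
  -- the complementary side is undamaged.
  undamaged-side : ∀ {A} → Separation A → UndamagedSide A
  undamaged-side σ with Separation.S σ u₁ in S₁ | Separation.S σ u₂ in S₂
  ... | false | false = record { separation = σ ; undamaged = λ where
                          v Sv (inj₁ refl) → not-¬ Sv S₁
                          v Sv (inj₂ refl) → not-¬ Sv S₂ }
  ... | true  | _     = complement-undamaged σ λ where
                          (inj₁ refl) → inj₁ S₁
                          (inj₂ refl) → Separation.S-closed σ u₁ u₂ S₁ edge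
  ... | false | true  = complement-undamaged σ λ where
                          (inj₁ refl) → Separation.S-closed σ u₂ u₁ S₂ (hadj-sym edge)
                          (inj₂ refl) → inj₁ S₂

  module _ {A : List (Fin n)} (σ : UndamagedSide A) where
    open UndamagedSide σ

    restrict-separator : ∀ {B} → (∀ {x} → x ∈ B → x ∈ A) →
                         (∀ v w → S v ≡ true → hadj v w ≡ true → w ∈ A → w ∈ B) → UndamagedSide B
    restrict-separator B⊆A into-B = record
      { separation = record
          { S = S ; S⊆V = S⊆V ; A∉S = A∉S ∘ B⊆A
          ; S-closed = λ v w Sv vw → Data.Sum.map₂ (into-B v w Sv vw) (S-closed v w Sv vw)
          ; s = s ; s∈S = s∈S ; t = t ; t∈V = t∈V ; t∉S = t∉S ; t∉A = t∉A ∘ B⊆A }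
      ; undamaged = undamaged }

    Attached : Fin n → Set
    Attached x = ∃ λ d → S d ≡ true × hadj x d ≡ true

    attached? : ∀ x → Dec (Attached x)
    attached? x = any? λ d → S d ≟ᵇ true ×-dec hadj x d ≟ᵇ true

    unattached-edge : ∀ {x v} → ¬ Attached x → S v ≡ true → hadj v x ≢ true
    unattached-edge {v = v} ¬att Sv vx = ¬att (v , Sv , hadj-sym vx)

module MinimalContraction {n : ℕ} {G : Graph n} (H : TwoContraction G) (minimal : Minimal H)
  (deg≥3 : ∀ v → TwoContraction.inV H v ≡ true → ¬ Damaged H v →
           3 ≤ deg (TwoContraction.hadj H) v) where
  open Graph G using (adj) renaming (sym to adj-sym)
  open TwoContraction H
  open Adjacency H
  open Shrinking H
  open Separations H
  open DecMembership (_≟_ {n}) using (_∈?_)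

  neighbourhood-count≥4 : ∀ {W : Fin n → Bool} c → inV c ≡ true → ¬ Damaged H c → W c ≡ true →
                          (∀ w → hadj c w ≡ true → W w ≡ true) → 4 ≤ count W
  neighbourhood-count≥4 c c∈V c-undamaged Wc N⊆W =
    ≤-trans (s≤s (deg≥3 c c∈V c-undamaged)) (count-mono-< N⊆W c Wc (hirr c))

  module _ {A : List (Fin n)} (σ : UndamagedSide A) where
    open UndamagedSide σ

    no-detour : ∀ a b → a ≢ b → S∪A a ≡ true → S∪A b ≡ true →
                All (λ x → x ≡ a ⊎ x ≡ b) A → All (λ x → inV x ≡ true) A →
                ¬ Path adj (λ w → S∪A w ≡ false) a b
    no-detour a b a≢b a∈ b∈ A⊆ab A⊆V detour =
      minimal (shrink shrinkable) (shrink-smaller shrinkable)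
      where
      inner-in-S : ∀ v → S∪A v ≡ true → v ≢ a → v ≢ b → S v ≡ true
      inner-in-S v e v≢a v≢b with from-does (S∪A? v) e
      ... | inj₁ Sv  = Sv
      ... | inj₂ v∈A = ⊥-elim ([ v≢a , v≢b ] (All.lookup A⊆ab v∈A))

      S-closed′ : ∀ v → S v ≡ true → ∀ w → hadj v w ≡ true → S∪A w ≡ true
      S-closed′ v Sv w vw = dec-true (S∪A? w) (S-closed v w Sv vw)

      shrinkable : Shrinkable
      shrinkable = record
        { W = S∪A ; W⊆V = S∪A⊆V A⊆V
        ; a = a ; b = b ; a≢b = a≢b ; a∈W = a∈ ; b∈W = b∈
        ; inner-undamaged = λ v e v≢a v≢b → undamaged v (inner-in-S v e v≢a v≢b)
        ; inner-closed    = λ v e v≢a v≢b → S-closed′ v (inner-in-S v e v≢a v≢b)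
        ; W≥3 = ≤-trans (s≤s (s≤s (s≤s z≤n)))
                  (neighbourhood-count≥4 s (S⊆V s s∈S) (undamaged s s∈S)
                                         (S⊆S∪A s s∈S) (S-closed′ s s∈S))
        ; z = t ; z∈V = t∈V ; z∉W = t∉S∪A
        ; detour = detour }

    -- As d is undamaged, the new edge xd is an edge of G and serves as its own detour.
    no-attachment : ∀ x → S∪A x ≡ true → All (_≡ x) A → ¬ Attached σ x
    no-attachment x x∈ A≡x (d , Sd , xd) =
      no-detour x d x≢d x∈ (S⊆S∪A d Sd) (All.map inj₁ A≡x)
        (All.map (λ { refl → hdom x d xd }) A≡x)
        (edge-path adj x≢d (sub x d xd λ l → undamaged d Sd (proj₂ (link-ends l))))
      where
      x≢d : x ≢ d
      x≢d refl = not-¬ xd (hirr x)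

  no-undamaged-side₀ : ¬ UndamagedSide []
  no-undamaged-side₀ σ = no-attachment σ s (S⊆S∪A s s∈S) [] (d , Sd , sd)
    where
    open UndamagedSide σ
    neighbour : ∃ λ d → hadj s d ≡ true
    neighbour = count-nonempty (hadj s)
      (≤-trans (s≤s z≤n) (deg≥3 s (S⊆V s s∈S) (undamaged s s∈S)))
    d : Fin n
    d = proj₁ neighbour
    sd : hadj s d ≡ true
    sd = proj₂ neighbour
    Sd : S d ≡ true
    Sd = fromInj₁ (λ ()) (S-closed s d s∈S sd)

  no-undamaged-side₁ : ∀ a → ¬ UndamagedSide (a ∷ [])
  no-undamaged-side₁ a σ with attached? σ a
  ... | yes attached = no-attachment σ a (UndamagedSide.A⊆S∪A σ (here refl)) (refl ∷ []) attached
  ... | no unattached = no-undamaged-side₀ (restrict-separator σ (λ ()) λ where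
                          v w Sv vw (here refl) → ⊥-elim (unattached-edge σ unattached Sv vw))

  module Between (a b : Fin n) (a≢b : a ≢ b) (σ : UndamagedSide (a ∷ b ∷ []))
                 (a∈V : inV a ≡ true) (b∈V : inV b ≡ true) where
    open UndamagedSide σ

    open Reachability adj (λ v → S∪A v ≟ᵇ false) a
    open Reachable reachable

    a∈S∪A : S∪A a ≡ true
    a∈S∪A = A⊆S∪A (here refl)

    b∈S∪A : S∪A b ≡ true
    b∈S∪A = A⊆S∪A (there (here refl))

    outside-V-free : ∀ {v} → inV v ≡ false → S∪A v ≡ false
    outside-V-free v∉V = ¬-not λ e → not-¬ (S∪A⊆V (a∈V ∷ b∈V ∷ []) _ e) v∉V

    R-free : ∀ v → R v ≡ true → v ≢ a → S∪A v ≡ false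
    R-free v Rv v≢a with R-sound v Rv
    ... | inj₁ v≡a       = ⊥-elim (v≢a v≡a)
    ... | inj₂ (free , _) = free

    b∉R : R b ≡ false
    b∉R = ¬-not λ Rb → not-¬ b∈S∪A (R-free b Rb (a≢b ∘ sym))

    -- The edge u₁u₂ of H is realised in G by its detour, whose interior lies outside H.
    lift : ∀ v w → R v ≡ true → hadj v w ≡ true → ∃ λ r → R r ≡ true × adj r w ≡ true
    lift v w Rv vw with link? u₁ u₂ v w | path
    ... | no ¬l                    | _ = v , Rv , sub v w vw ¬l
    ... | yes (inj₁ (refl , refl)) | ws , walk , _ , out =
      last-edge-from R-closed u₁ ws u₂ walk (All.map outside-V-free out) Rv
    ... | yes (inj₂ (refl , refl)) | ws , walk , _ , out =
      first-edge-into R-closed adj-sym u₁ ws u₂ walk (All.map outside-V-free out) Rv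

    detour-via : ∀ r → R r ≡ true → adj r b ≡ true → Path adj (λ w → S∪A w ≡ false) a b
    detour-via r Rr rb with R-sound r Rr
    ... | inj₁ refl      = edge-path adj a≢b rb
    ... | inj₂ (r-free , p) = path-snoc adj p r-free rb λ b∈ →
        All.lookup (a≢b ∷ ++⁺ (All.map free≢b (Path.interior-P p)) (free≢b r-free ∷ [])) b∈ refl
      where
      free≢b : ∀ {x} → S∪A x ≡ false → x ≢ b
      free≢b x-free refl = not-¬ b∈S∪A x-free

    b-unreachable : ∀ r → R r ≡ true → adj r b ≡ true → ⊥
    b-unreachable r Rr rb =
      no-detour σ a b a≢b a∈S∪A b∈S∪A (inj₁ refl ∷ inj₂ refl ∷ []) (a∈V ∷ b∈V ∷ [])
        (detour-via r Rr rb)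

    R-closedᴴ : ∀ v w → R v ≡ true → hadj v w ≡ true → S∪A w ≡ false → R w ≡ true
    R-closedᴴ v w Rv vw w-free with lift v w Rv vw
    ... | r , Rr , rw = R-closed r w Rr rw w-free

    b-unreachableᴴ : ∀ v → R v ≡ true → hadj v b ≢ true
    b-unreachableᴴ v Rv vb with lift v b Rv vb
    ... | r , Rr , rb = b-unreachable r Rr rb

    R′? : ∀ v → Dec (R v ≡ true × inV v ≡ true × v ≢ a)
    R′? v = R v ≟ᵇ true ×-dec inV v ≟ᵇ true ×-dec ¬? (v ≟ a)

    R′ : Fin n → Bool
    R′ v = does (R′? v)

    R′-separation : ∀ r → R′ r ≡ true → Separation (a ∷ [])
    R′-separation r r∈ = record
      { S = R′ ; S⊆V = λ v e → proj₁ (proj₂ (from-does (R′? v) e))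
      ; A∉S = λ { (here refl) → dec-false (R′? a) λ (_ , _ , a≢a) → a≢a refl }
      ; S-closed = R′-closed
      ; s = r ; s∈S = r∈
      ; t = b ; t∈V = b∈V ; t∉S = dec-false (R′? b) (λ (Rb , _) → not-¬ Rb b∉R)
      ; t∉A = λ { (here b≡a) → a≢b (sym b≡a) } }
      where
      R′-closed : ∀ v w → R′ v ≡ true → hadj v w ≡ true → R′ w ≡ true ⊎ w ∈ a ∷ []
      R′-closed v w e vw with from-does (R′? v) e
      ... | Rv , _ , v≢a = Data.Sum.map inside here (Data.Sum.swap (toSum (w ≟ a)))
        where
        w-free : w ≢ a → S∪A w ≡ false
        w-free w≢a = dec-false (S∪A? w) λ where
          (inj₁ Sw)                  →
            not-¬ (dec-true (S∪A? v) (S-closed w v Sw (hadj-sym vw))) (R-free v Rv v≢a)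
          (inj₂ (here w≡a))          → w≢a w≡a
          (inj₂ (there (here refl))) → b-unreachableᴴ v Rv vw
        inside : w ≢ a → R′ w ≡ true
        inside w≢a = dec-true (R′? w) (R-closedᴴ v w Rv vw (w-free w≢a) , hdomʳ vw , w≢a)

    S+a? : ∀ v → Dec (S v ≡ true ⊎ v ≡ a)
    S+a? v = S v ≟ᵇ true ⊎-dec v ≟ a

    S+a-separation : ¬ (∃ λ r → R′ r ≡ true) → Separation (b ∷ [])
    S+a-separation R′-empty = record
      { S = λ v → does (S+a? v)
      ; S⊆V = λ v e → [ S⊆V v , (λ { refl → a∈V }) ] (from-does (S+a? v) e)
      ; A∉S = λ { (here refl) → dec-false (S+a? b) [ not-¬ (A∉S (there (here refl))) , a≢b ∘ sym ] }
      ; S-closed = closed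
      ; s = s ; s∈S = dec-true (S+a? s) (inj₁ s∈S)
      ; t = t ; t∈V = t∈V
      ; t∉S = dec-false (S+a? t) [ not-¬ t∉S , (λ t≡a → t∉A (here t≡a)) ]
      ; t∉A = λ { (here t≡b) → t∉A (there (here t≡b)) } }
      where
      a-nbr-in-S : ∀ w → hadj a w ≡ true → S w ≡ true
      a-nbr-in-S w aw = decidable-stable (S w ≟ᵇ true) λ w∉S →
        R′-empty (w , dec-true (R′? w) (R-closedᴴ a w R-source aw (w-free w∉S) , hdomʳ aw , w≢a))
        where
        w≢a : w ≢ a
        w≢a refl = not-¬ aw (hirr a)
        w-free : S w ≢ true → S∪A w ≡ false
        w-free w∉S = dec-false (S∪A? w) λ where
          (inj₁ Sw)                  → w∉S Sw
          (inj₂ (here w≡a))          → w≢a w≡a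
          (inj₂ (there (here refl))) → b-unreachableᴴ a R-source aw

      closed : ∀ v w → does (S+a? v) ≡ true → hadj v w ≡ true →
               does (S+a? w) ≡ true ⊎ w ∈ b ∷ []
      closed v w e vw with from-does (S+a? v) e
      ... | inj₂ refl = inj₁ (dec-true (S+a? w) (inj₁ (a-nbr-in-S w vw)))
      ... | inj₁ Sv with S-closed v w Sv vw
      ...   | inj₁ Sw                 = inj₁ (dec-true (S+a? w) (inj₁ Sw))
      ...   | inj₂ (here w≡a)         = inj₁ (dec-true (S+a? w) (inj₂ w≡a))
      ...   | inj₂ (there (here w≡b)) = inj₂ (here w≡b)

    absurd : ⊥
    absurd with any? (λ r → R′ r ≟ᵇ true)
    ... | yes (r , r∈) = no-undamaged-side₁ a (undamaged-side (R′-separation r r∈))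
    ... | no R′-empty  = no-undamaged-side₁ b (undamaged-side (S+a-separation R′-empty))

  no-undamaged-side₂ : ∀ a b → ¬ UndamagedSide (a ∷ b ∷ [])
  no-undamaged-side₂ a b σ with a ≟ b | attached? σ a | attached? σ b
  ... | yes refl | _ | _ =
    no-undamaged-side₁ a (restrict-separator σ there λ where
      _ _ _ _ (here w≡a)         → here w≡a
      _ _ _ _ (there (here w≡a)) → here w≡a)
  ... | no _ | no a-unattached | _ =
    no-undamaged-side₁ b (restrict-separator σ there λ where
      v w Sv vw (here refl)      → ⊥-elim (unattached-edge σ a-unattached Sv vw)
      _ _ _ _ (there (here w≡b)) → here w≡b)
  ... | no _ | yes _ | no b-unattached =
    no-undamaged-side₁ a (restrict-separator σ (λ { (here x≡a) → here x≡a }) λ where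
      _ _ _ _ (here w≡a)            → here w≡a
      v w Sv vw (there (here refl)) → ⊥-elim (unattached-edge σ b-unattached Sv vw))
  ... | no a≢b | yes (d , _ , ad) | yes (d′ , _ , bd′) =
    Between.absurd a b a≢b σ (hdom a d ad) (hdom b d′ bd′)

  no-undamaged-side : ∀ A → length A ≤ 2 → ¬ UndamagedSide A
  no-undamaged-side []              _ = no-undamaged-side₀
  no-undamaged-side (a ∷ [])        _ = no-undamaged-side₁ a
  no-undamaged-side (a ∷ b ∷ [])    _ = no-undamaged-side₂ a b
  no-undamaged-side (_ ∷ _ ∷ _ ∷ _) (s≤s (s≤s ()))

  module Avoiding (X : List (Fin n)) (|X|≤2 : length X ≤ 2)
                  (x : Fin n) (x∈V : inV x ≡ true) (x∉X : x ∉ X) where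
    open Reachability hadj (λ v → inV v ≟ᵇ true ×-dec ¬? (v ∈? X)) x
    open Reachable reachable

    R-separation : ∀ y → inV y ≡ true → y ∉ X → R y ≡ false → Separation X
    R-separation y y∈V y∉X y∉R = record
      { S = R
      ; S⊆V = λ v Rv → [ (λ { refl → x∈V }) , (λ ((v∈V , _) , _) → v∈V) ] (R-sound v Rv)
      ; A∉S = X∉R
      ; S-closed = λ v w Rv vw → Data.Sum.map₁ (λ w∉X → R-closed v w Rv vw (hdomʳ vw , w∉X))
                                   (Data.Sum.swap (toSum (w ∈? X)))
      ; s = x ; s∈S = R-source
      ; t = y ; t∈V = y∈V ; t∉S = y∉R ; t∉A = y∉X }
      where
      X∉R : ∀ {v} → v ∈ X → R v ≡ false
      X∉R {v} v∈X = ¬-not λ Rv →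
        [ (λ { refl → x∉X v∈X }) , (λ ((_ , v∉X) , _) → v∉X v∈X) ] (R-sound v Rv)

    connected-to : ∀ y → inV y ≡ true → y ∉ X →
                   x ≡ y ⊎ ∃ λ ws → IsWalk hadj (x ∷ ws ++ y ∷ []) × All (_∉ X) ws
    connected-to y y∈V y∉X with R y in Ry
    ... | false = ⊥-elim (no-undamaged-side X |X|≤2 (undamaged-side (R-separation y y∈V y∉X Ry)))
    ... | true with R-sound y Ry
    ...   | inj₁ y≡x     = inj₁ (sym y≡x)
    ...   | inj₂ (_ , p) = inj₂ (interior , walk , All.map proj₂ interior-P)
      where open Path p

  undamaged-vertex : ∃ λ v → inV v ≡ true × ¬ Damaged H v
  undamaged-vertex = v , v∈V , [ v≢u₁ , v≢u₂ ]
    where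
    V∖u₁∖u₂ : Fin n → Bool
    V∖u₁∖u₂ v = not (does (v ≟ u₂)) ∧ (not (does (v ≟ u₁)) ∧ inV v)
    3≤2+ : 3 ≤ 2 + count V∖u₁∖u₂
    3≤2+ = ≤-trans size≥3 (≤-trans (count-remove inV u₁) (s≤s (count-remove _ u₂)))
    witness : ∃ λ v → V∖u₁∖u₂ v ≡ true
    witness = count-nonempty V∖u₁∖u₂ (≤-pred (≤-pred 3≤2+))
    v : Fin n
    v = proj₁ witness
    v∈V∖u₁ : not (does (v ≟ u₁)) ∧ inV v ≡ true
    v∈V∖u₁ = ∧-conicalʳ (not (does (v ≟ u₂))) _ (proj₂ witness)
    v≢u₂ : v ≢ u₂
    v≢u₂ = from-does (¬? (v ≟ u₂)) (∧-conicalˡ (not (does (v ≟ u₂))) _ (proj₂ witness))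
    v≢u₁ : v ≢ u₁
    v≢u₁ = from-does (¬? (v ≟ u₁)) (∧-conicalˡ (not (does (v ≟ u₁))) _ v∈V∖u₁)
    v∈V : inV v ≡ true
    v∈V = ∧-conicalʳ (not (does (v ≟ u₁))) _ v∈V∖u₁

  four-vertices : 4 ≤ count inV
  four-vertices with undamaged-vertex
  ... | v , v∈V , undamaged = neighbourhood-count≥4 v v∈V undamaged v∈V (λ _ → hdomʳ)

  three-connected : ThreeConnected H
  three-connected = four-vertices , λ X |X|≤2 x y x∈V y∈V x∉X y∉X →
    Avoiding.connected-to X |X|≤2 x x∈V x∉X y y∈V y∉X

low-degree? : ∀ {n} {G : Graph n} (H : TwoContraction G) → Dec (HasLowNonDamaged H)
low-degree? H = any? λ v →
  inV v ≟ᵇ true ×-dec ¬? (v ≟ u₁) ×-dec ¬? (v ≟ u₂) ×-dec deg hadj v ≤? 4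
  where open TwoContraction H

claim8 : ∀ {n : ℕ} (G : Graph n) → Planar G → Connected G →
         (H : TwoContraction G) → Minimal H →
         HasLowNonDamaged H ⊎ ThreeConnected H
claim8 G _ _ H minimal with low-degree? H
... | yes low = inj₁ low
... | no ¬low = inj₂ (MinimalContraction.three-connected H minimal deg≥3)
  where
  open TwoContraction H
  deg≥3 : ∀ v → inV v ≡ true → ¬ Damaged H v → 3 ≤ deg hadj v
  deg≥3 v v∈V undamaged = ≤-trans (s≤s (s≤s (s≤s z≤n)))
    (≰⇒> λ ≤4 → ¬low (v , v∈V , undamaged ∘ inj₁ , undamaged ∘ inj₂ , ≤4))
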